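{- Let $k, k', l$ be integers with $0 \le k < k' \le l$. Then for every integer $g$ with $0 \le g \le l-k'$, the games $W_{k,l}$ and $W_{k',l}$ have exactly the same set of positions with nim-value $g$.
   Context: Positions are pairs $(a,b)$ of nonnegative integers. For integers $0 \le k \le l$, the impartial game $W_{k,l}$ (normal play: the last player able to move wins) allows from $(a,b)$ the following moves: a Nim move to $(a-s,b)$ or $(a,b-s)$ for any integer $s>0$ keeping coordinates nonnegative; and a diagonal move to $(a-s,b-s)$ with $s>0$, allowed only if $\min(a-s,b-s) \ge k$ and $\max(a-s,b-s) \ge l$. The nim-value (Sprague–Grundy value) of a position is defined recursively: it is the minimum excluded nonnegative integer (mex) of the set of nim-values of positions reachable in one move (so terminal positions have nim-value $0$). A $g$-position is a position with nim-value $g$. -}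

module Defs where

open import Data.Nat using (ℕ; zero; suc; _+_; _∸_; _⊓_; _⊔_; _≤ᵇ_; _≡ᵇ_)
open import Data.Bool using (Bool; true; false; if_then_else_; _∧_)
open import Data.Bool.ListAction using (any)
open import Data.List using (List; []; _∷_; map; length; filterᵇ; applyUpTo; downFrom; _++_)
open import Data.Product using (_×_; _,_)

Pos : Set
Pos = ℕ × ℕ

-- All positions reachable in one move of W_{k,l} from (a , b).
--  * Nim moves: (x , b) for x < a, and (a , y) for y < b.
--  * Diagonal moves: (a ∸ s , b ∸ s) for 1 ≤ s ≤ min a b, allowed only if
--    min (a-s) (b-s) ≥ k and max (a-s) (b-s) ≥ l.
moves : ℕ → ℕ → ℕ → ℕ → List Pos
moves k l a b =
  map (λ x → (x , b)) (downFrom a)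
  ++ map (λ y → (a , y)) (downFrom b)
  ++ map (λ s → (a ∸ s , b ∸ s))
         (filterᵇ (λ s → (k ≤ᵇ ((a ∸ s) ⊓ (b ∸ s))) ∧ (l ≤ᵇ ((a ∸ s) ⊔ (b ∸ s))))
                  (applyUpTo suc (a ⊓ b)))

_∈ᵇ_ : ℕ → List ℕ → Bool
n ∈ᵇ xs = any (λ x → n ≡ᵇ x) xs

-- mex: least natural number not in the list.  Searching n, n+1, … for at most
-- (length xs) steps suffices, since mex xs ≤ length xs.
mexFrom : ℕ → ℕ → List ℕ → ℕ
mexFrom n zero    xs = n
mexFrom n (suc f) xs = if n ∈ᵇ xs then mexFrom (suc n) f xs else n

mex : List ℕ → ℕ
mex xs = mexFrom 0 (length xs) xs

-- Sprague–Grundy value with fuel.  Every move strictly decreases a + b, so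
-- fuel a + b is always enough (terminal position (0,0) needs no recursion).
nvFuel : ℕ → ℕ → ℕ → ℕ → ℕ → ℕ
nvFuel k l zero    a b = 0
nvFuel k l (suc f) a b = mex (map (λ { (x , y) → nvFuel k l f x y }) (moves k l a b))

nimValue : ℕ → ℕ → ℕ → ℕ → ℕ
nimValue k l a b = nvFuel k l (a + b) a b

module Submission where

-- The two games differ only in the diagonal moves of W_{k,l} that land on a
-- position (c , d) with min c d < k′ and max c d ≥ l.  The key estimate is that
-- such a "straddling" position has nim-value > l ∸ k′ in W_{k,l}: if c < l ≤ d,
-- every value v with c + v < l already occurs in the row (c , _) below l (a
-- pigeonhole count, since positions below l only admit Nim moves), so the
-- value of (c , d) is at least l ∸ c.  Hence, by induction on a + b, both games
-- offer from (a , b) options of exactly the same values ≤ l ∸ k′, and by the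
-- mex characterisation of nim-values they assign the value g ≤ l ∸ k′ to the
-- same positions.

open import Defs
open import Data.Nat
open import Data.Nat.Properties
open import Data.Nat.Induction using (<-rec)
open import Data.Bool using (T; T?; _∧_; true; false)
open import Data.Bool.Properties using (T-∧)
open import Data.List using (map; length; lookup; filterᵇ; applyUpTo; downFrom)
open import Data.List.Properties using (map-cong-local)
open import Data.List.Membership.Propositional using (_∈_; _∉_)
open import Data.List.Membership.Propositional.Properties
open import Data.List.Relation.Unary.All using (tabulate)
import Data.List.Relation.Unary.Any as Any
open import Data.List.Relation.Unary.Any.Properties using (any⁺; any⁻; lookup-index)
open import Data.Fin using (Fin; toℕ; fromℕ<)
open import Data.Fin.Properties using (pigeonhole; injective⇒≤; toℕ-injective; toℕ<n; toℕ-fromℕ<; any?)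
open import Data.Product using (∃; Σ; _×_; _,_; proj₁; proj₂; swap)
open import Data.Sum using (_⊎_; inj₁; inj₂)
open import Data.Empty using (⊥; ⊥-elim)
open import Relation.Nullary using (¬_; yes; no)
open import Relation.Binary.Definitions using (tri<; tri≈; tri>)
open import Relation.Binary.PropositionalEquality
open import Function.Bundles using (_⇔_; mk⇔; Equivalence)
import Function.Properties.Equivalence as ⇔

DiagonalLegal : ℕ → ℕ → ℕ → ℕ → ℕ → Set
DiagonalLegal k l a b s = k ≤ (a ∸ s) ⊓ (b ∸ s) × l ≤ (a ∸ s) ⊔ (b ∸ s)

data Move (k l a b : ℕ) : Pos → Set where
  left  : ∀ x → x < a → Move k l a b (x , b)
  right : ∀ y → y < b → Move k l a b (a , y)
  diag  : ∀ s → 0 < s → s ≤ a ⊓ b → DiagonalLegal k l a b s → Move k l a b (a ∸ s , b ∸ s)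

Move⇒∈moves : ∀ {k l a b q} → Move k l a b q → q ∈ moves k l a b
Move⇒∈moves {a = a} {b} (left x x<a) = ∈-++⁺ˡ (∈-map⁺ (λ x → (x , b)) (∈-downFrom⁺ x<a))
Move⇒∈moves {a = a} {b} (right y y<b) =
  ∈-++⁺ʳ (map (λ x → (x , b)) (downFrom a)) (∈-++⁺ˡ (∈-map⁺ (λ y → (a , y)) (∈-downFrom⁺ y<b)))
Move⇒∈moves {k} {l} {a} {b} (diag (suc s) _ s<a⊓b (k≤ , l≤)) =
  ∈-++⁺ʳ (map (λ x → (x , b)) (downFrom a)) (∈-++⁺ʳ (map (λ y → (a , y)) (downFrom b))
    (∈-map⁺ (λ s → (a ∸ s , b ∸ s))
      (∈-filter⁺ (λ s → T? ((k ≤ᵇ (a ∸ s) ⊓ (b ∸ s)) ∧ (l ≤ᵇ (a ∸ s) ⊔ (b ∸ s))))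
        (∈-applyUpTo⁺ suc s<a⊓b)
        (Equivalence.from T-∧ (≤⇒≤ᵇ k≤ , ≤⇒≤ᵇ l≤)))))

∈moves⇒Move : ∀ {k l a b q} → q ∈ moves k l a b → Move k l a b q
∈moves⇒Move {k} {l} {a} {b} q∈ with ∈-++⁻ (map (λ x → (x , b)) (downFrom a)) q∈
... | inj₁ q∈left with x , x∈ , refl ← ∈-map⁻ (λ x → (x , b)) q∈left = left x (∈-downFrom⁻ x∈)
... | inj₂ q∈rest with ∈-++⁻ (map (λ y → (a , y)) (downFrom b)) q∈rest
...   | inj₁ q∈right with y , y∈ , refl ← ∈-map⁻ (λ y → (a , y)) q∈right = right y (∈-downFrom⁻ y∈)
...   | inj₂ q∈diag with s , s∈ , refl ← ∈-map⁻ (λ s → (a ∸ s , b ∸ s)) q∈diag = diagonal s∈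
  where
  diagonal : ∀ {s} → s ∈ filterᵇ (λ s → (k ≤ᵇ (a ∸ s) ⊓ (b ∸ s)) ∧ (l ≤ᵇ (a ∸ s) ⊔ (b ∸ s)))
                                 (applyUpTo suc (a ⊓ b))
           → Move k l a b (a ∸ s , b ∸ s)
  diagonal s∈
    with ∈-filter⁻ (λ s → T? ((k ≤ᵇ (a ∸ s) ⊓ (b ∸ s)) ∧ (l ≤ᵇ (a ∸ s) ⊔ (b ∸ s))))
                   {xs = applyUpTo suc (a ⊓ b)} s∈
  ... | s∈range , legal with ∈-applyUpTo⁻ suc s∈range
  ...   | i , i<a⊓b , refl with Equivalence.to T-∧ legal
  ...     | k≤ , l≤ = diag (suc i) z<s i<a⊓b (≤ᵇ⇒≤ _ _ k≤ , ≤ᵇ⇒≤ _ _ l≤)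

move-decreases : ∀ {k l a b x y} → Move k l a b (x , y) → x + y < a + b
move-decreases {b = b} (left x x<a) = +-monoˡ-< b x<a
move-decreases {a = a} (right y y<b) = +-monoʳ-< a y<b
move-decreases {a = a} {b} (diag s 0<s s≤a⊓b _) =
  +-mono-< (∸-monoʳ-< 0<s (≤-trans s≤a⊓b (m⊓n≤m a b)))
           (∸-monoʳ-< 0<s (≤-trans s≤a⊓b (m⊓n≤n a b)))

move-swap : ∀ {k l a b q} → Move k l a b q → Move k l b a (swap q)
move-swap (left x x<a) = right x x<a
move-swap (right y y<b) = left y y<b
move-swap {a = a} {b} (diag s 0<s s≤a⊓b (k≤ , l≤)) =
  diag s 0<s (subst (s ≤_) (⊓-comm a b) s≤a⊓b)
    (subst (_ ≤_) (⊓-comm (a ∸ s) (b ∸ s)) k≤ , subst (_ ≤_) (⊔-comm (a ∸ s) (b ∸ s)) l≤)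

diagonal-from-large : ∀ {k l} a b s → DiagonalLegal k l a b s → l ≤ a ⊔ b
diagonal-from-large a b s (_ , l≤) = ≤-trans l≤ (⊔-mono-≤ (m∸n≤m a s) (m∸n≤m b s))

move-weaken : ∀ {k k′ l a b q} → k ≤ k′ → Move k′ l a b q → Move k l a b q
move-weaken _ (left x x<a) = left x x<a
move-weaken _ (right y y<b) = right y y<b
move-weaken k≤k′ (diag s 0<s s≤a⊓b (k′≤ , l≤)) = diag s 0<s s≤a⊓b (≤-trans k≤k′ k′≤ , l≤)

move-strengthen : ∀ {k k′ l a b x y} → Move k l a b (x , y) →
                  Move k′ l a b (x , y) ⊎ (x ⊓ y < k′ × l ≤ x ⊔ y)
move-strengthen (left x x<a) = inj₁ (left x x<a)
move-strengthen (right y y<b) = inj₁ (right y y<b)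
move-strengthen {k′ = k′} {a = a} {b} (diag s 0<s s≤a⊓b (_ , l≤)) with k′ ≤? (a ∸ s) ⊓ (b ∸ s)
... | yes k′≤ = inj₁ (diag s 0<s s≤a⊓b (k′≤ , l≤))
... | no k′≰ = inj₂ (≰⇒> k′≰ , l≤)

∈ᵇ⇒∈ : ∀ n xs → T (n ∈ᵇ xs) → n ∈ xs
∈ᵇ⇒∈ n xs t = Any.map (≡ᵇ⇒≡ n _) (any⁻ _ xs t)

∈⇒∈ᵇ : ∀ {n xs} → n ∈ xs → T (n ∈ᵇ xs)
∈⇒∈ᵇ {n} n∈ = any⁺ _ (Any.map (λ {x} → ≡⇒≡ᵇ n x) n∈)

IsMex : (ℕ → Set) → ℕ → Set
IsMex O g = (∀ u → u < g → O u) × ¬ O g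

IsMex-cong : ∀ {O O′ : ℕ → Set} {g} → (∀ w → w ≤ g → O w ⇔ O′ w) → IsMex O g ⇔ IsMex O′ g
IsMex-cong {O} {O′} {g} O⇔O′ = mk⇔ (transport O⇔O′) (transport (λ w w≤g → ⇔.sym (O⇔O′ w w≤g)))
  where
  transport : ∀ {P Q : ℕ → Set} → (∀ w → w ≤ g → P w ⇔ Q w) → IsMex P g → IsMex Q g
  transport P⇔Q (below , absent) =
    (λ u u<g → Equivalence.to (P⇔Q u (<⇒≤ u<g)) (below u u<g)) ,
    (λ Qg → absent (Equivalence.from (P⇔Q _ ≤-refl) Qg))

mexFrom-spec : ∀ n f xs → (∀ u → u < n → u ∈ xs) →
               (∀ u → u < mexFrom n f xs → u ∈ xs) × (mexFrom n f xs ∉ xs ⊎ mexFrom n f xs ≡ n + f)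
mexFrom-spec n zero xs below = below , inj₂ (sym (+-identityʳ n))
mexFrom-spec n (suc f) xs below with n ∈ᵇ xs in found
... | false = below , inj₁ (λ n∈ → subst T found (∈⇒∈ᵇ n∈))
... | true with mexFrom-spec (suc n) f xs below′
  where
  below′ : ∀ u → u < suc n → u ∈ xs
  below′ u u<1+n with m≤n⇒m<n∨m≡n (s≤s⁻¹ u<1+n)
  ... | inj₁ u<n = below u u<n
  ... | inj₂ refl = ∈ᵇ⇒∈ u xs (subst T (sym found) _)
...   | below″ , inj₁ absent = below″ , inj₁ absent
...   | below″ , inj₂ exhausted = below″ , inj₂ (trans exhausted (sym (+-suc n f)))

contains-range⇒long : ∀ n xs → (∀ u → u ≤ n → u ∈ xs) → n < length xs
contains-range⇒long n xs has = injective⇒≤ position-injective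
  where
  position : Fin (suc n) → Fin (length xs)
  position i = Any.index (has (toℕ i) (s≤s⁻¹ (toℕ<n i)))
  position-injective : ∀ {i j} → position i ≡ position j → i ≡ j
  position-injective {i} {j} eq = toℕ-injective (begin
    toℕ i                  ≡⟨ lookup-index (has (toℕ i) _) ⟩
    lookup xs (position i) ≡⟨ cong (lookup xs) eq ⟩
    lookup xs (position j) ≡⟨ sym (lookup-index (has (toℕ j) _)) ⟩
    toℕ j                  ∎)
    where open ≡-Reasoning

mex-isMex : ∀ xs → IsMex (_∈ xs) (mex xs)
mex-isMex xs with mexFrom-spec 0 (length xs) xs (λ _ ())
... | below , inj₁ absent = below , absent
... | below , inj₂ exhausted = below , λ mex∈ → <-irrefl refl (contains-range⇒long (length xs) xs (has mex∈))
  where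
  has : mex xs ∈ xs → ∀ u → u ≤ length xs → u ∈ xs
  has mex∈ u u≤ with m≤n⇒m<n∨m≡n u≤
  ... | inj₁ u<len = below u (subst (u <_) (sym exhausted) u<len)
  ... | inj₂ refl = subst (_∈ xs) exhausted mex∈

mex-char : ∀ xs g → mex xs ≡ g ⇔ IsMex (_∈ xs) g
mex-char xs g = mk⇔ (λ { refl → mex-isMex xs }) unique
  where
  unique : IsMex (_∈ xs) g → mex xs ≡ g
  unique (below , absent) with <-cmp (mex xs) g | mex-isMex xs
  ... | tri< mex<g _ _ | _ , mex∉ = ⊥-elim (mex∉ (below _ mex<g))
  ... | tri≈ _ mex≡g _ | _ = mex≡g
  ... | tri> _ _ g<mex | below′ , _ = ⊥-elim (absent (below′ g g<mex))

position-ind : (P : ℕ → ℕ → Set) →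
               (∀ a b → (∀ x y → x + y < a + b → P x y) → P a b) → ∀ a b → P a b
position-ind P step a b =
  <-rec (λ n → ∀ a b → a + b ≡ n → P a b)
        (λ { _ rec a b refl → step a b (λ x y x+y< → rec x+y< x y refl) })
        (a + b) a b refl

module Game (k l : ℕ) where

  value : Pos → ℕ
  value (x , y) = nimValue k l x y

  Option : ℕ → ℕ → ℕ → Set
  Option a b w = Σ Pos λ q → Move k l a b q × value q ≡ w

  fuel-irrelevant : ∀ f f′ a b → a + b ≤ f → a + b ≤ f′ → nvFuel k l f a b ≡ nvFuel k l f′ a b
  fuel-irrelevant zero    zero     a    b    _ _ = refl
  fuel-irrelevant zero    (suc f′) zero zero _ _ = refl
  fuel-irrelevant (suc f) zero     zero zero _ _ = refl
  fuel-irrelevant (suc f) (suc f′) a    b    ≤f ≤f′ =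
    cong mex (map-cong-local {xs = moves k l a b} (tabulate λ { {x , y} q∈ →
      let x+y<a+b = move-decreases (∈moves⇒Move {k} {l} {a} {b} q∈) in
      fuel-irrelevant f f′ x y (s≤s⁻¹ (≤-trans x+y<a+b ≤f)) (s≤s⁻¹ (≤-trans x+y<a+b ≤f′)) }))

  value-unfold : ∀ a b → nimValue k l a b ≡ mex (map value (moves k l a b))
  value-unfold a b = begin
    nvFuel k l (a + b) a b
      ≡⟨ fuel-irrelevant (a + b) (suc (a + b)) a b ≤-refl (n≤1+n _) ⟩
    nvFuel k l (suc (a + b)) a b
      ≡⟨ cong mex (map-cong-local {xs = moves k l a b} (tabulate λ { {x , y} q∈ →
           fuel-irrelevant (a + b) (x + y) x y
             (<⇒≤ (move-decreases (∈moves⇒Move {k} {l} {a} {b} q∈))) ≤-refl })) ⟩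
    mex (map value (moves k l a b)) ∎
    where open ≡-Reasoning

  value-char : ∀ a b g → nimValue k l a b ≡ g ⇔ IsMex (Option a b) g
  value-char a b g =
    ⇔.trans (≡-to-mex (value-unfold a b))
    (⇔.trans (mex-char (map value (moves k l a b)) g)
             (IsMex-cong (λ w _ → mk⇔ ∈-values⇒Option Option⇒∈-values)))
    where
    ≡-to-mex : ∀ {m n} → m ≡ n → m ≡ g ⇔ n ≡ g
    ≡-to-mex m≡n = mk⇔ (trans (sym m≡n)) (trans m≡n)
    ∈-values⇒Option : ∀ {w} → w ∈ map value (moves k l a b) → Option a b w
    ∈-values⇒Option w∈ with q , q∈ , w≡ ← ∈-map⁻ value w∈ = q , ∈moves⇒Move q∈ , sym w≡
    Option⇒∈-values : ∀ {w} → Option a b w → w ∈ map value (moves k l a b)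
    Option⇒∈-values (q , m , refl) = ∈-map⁺ value (Move⇒∈moves m)

  option-changes-value : ∀ {a b q} → Move k l a b q → value q ≢ nimValue k l a b
  option-changes-value {a} {b} m q≡ =
    proj₂ (Equivalence.to (value-char a b (nimValue k l a b)) refl) (_ , m , q≡)

  row-distinct : ∀ a {y y′} → y < y′ → nimValue k l a y ≢ nimValue k l a y′
  row-distinct a {y} y<y′ = option-changes-value {a} (right y y<y′)

  value-symmetric : ∀ a b → nimValue k l a b ≡ nimValue k l b a
  value-symmetric = position-ind _ λ a b IH →
    sym (Equivalence.from (value-char b a _)
          (Equivalence.to (IsMex-cong (λ w _ → options-swap IH))
            (Equivalence.to (value-char a b _) refl)))
    where
    options-swap : ∀ {a b w} → (∀ x y → x + y < a + b → nimValue k l x y ≡ nimValue k l y x) →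
                   Option a b w ⇔ Option b a w
    options-swap IH = mk⇔
      (λ { ((x , y) , m , w≡) → (y , x) , move-swap m , trans (sym (IH x y (move-decreases m))) w≡ })
      (λ { ((x , y) , m , w≡) → (y , x) , move-swap m , trans (IH y x (move-decreases (move-swap m))) w≡ })

  -- Positions below l admit only Nim moves, so along a row (a , _) every value
  -- v with a + v < l is attained at some y ≤ a + v: otherwise each of the
  -- a + v + 1 positions (a , y) would get a distinct label in [0 , a + v) —
  -- a + value if its value is below v, or the x < a of a left move to value v.
  row-attains : ∀ a v → a + v < l → ∃ λ y → y ≤ a + v × nimValue k l a y ≡ v
  row-attains a v a+v<l with any? (λ (i : Fin (suc (a + v))) → nimValue k l a (toℕ i) ≟ v)
  ... | yes (i , attained) = toℕ i , s≤s⁻¹ (toℕ<n i) , attained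
  ... | no unattained = ⊥-elim (collision (pigeonhole (n<1+n (a + v)) code))
    where
    Reason : ℕ → Set
    Reason y = nimValue k l a y < v ⊎ ∃ λ x → x < a × nimValue k l x y ≡ v

    reason : (i : Fin (suc (a + v))) → Reason (toℕ i)
    reason i with nimValue k l a (toℕ i) <? v
    ... | yes smaller = inj₁ smaller
    ... | no ≮v with proj₁ (Equivalence.to (value-char a (toℕ i) _) refl) v
                         (≤∧≢⇒< (≮⇒≥ ≮v) (λ v≡ → unattained (i , sym v≡)))
    ...   | _ , left x x<a , reached = inj₂ (x , x<a , reached)
    ...   | _ , right y y<i , reached =
            ⊥-elim (unattained (fromℕ< y<1+a+v , trans (cong (nimValue k l a) (toℕ-fromℕ< y<1+a+v)) reached))
            where y<1+a+v = <-trans y<i (toℕ<n i)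
    ...   | _ , diag s _ _ legal , _ =
            ⊥-elim (<⇒≱ (≤-<-trans (⊔-lub (m≤m+n a v) (s≤s⁻¹ (toℕ<n i))) a+v<l)
                        (diagonal-from-large a (toℕ i) s legal))

    label : ∀ {y} → Reason y → ℕ
    label {y} (inj₁ _) = a + nimValue k l a y
    label (inj₂ (x , _)) = x

    label<a+v : ∀ {y} (r : Reason y) → label r < a + v
    label<a+v (inj₁ smaller) = +-monoʳ-< a smaller
    label<a+v (inj₂ (_ , x<a , _)) = ≤-trans x<a (m≤m+n a v)

    code : Fin (suc (a + v)) → Fin (a + v)
    code i = fromℕ< (label<a+v (reason i))

    -- Distinct positions in the row get distinct labels, as values along rows and columns differ.
    labels-differ : ∀ {y y′} → y < y′ → (r : Reason y) (r′ : Reason y′) → label r ≢ label r′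
    labels-differ y<y′ (inj₁ _) (inj₁ _) same = row-distinct a y<y′ (+-cancelˡ-≡ a _ _ same)
    labels-differ y<y′ (inj₂ (x , _ , reached)) (inj₂ (_ , _ , reached′)) refl =
      row-distinct x y<y′ (trans reached (sym reached′))
    labels-differ _ (inj₁ _) (inj₂ (_ , x<a , _)) same = <⇒≱ x<a (subst (a ≤_) same (m≤m+n a _))
    labels-differ _ (inj₂ (_ , x<a , _)) (inj₁ _) same = <⇒≱ x<a (subst (a ≤_) (sym same) (m≤m+n a _))

    collision : (∃ λ i → ∃ λ j → i Data.Fin.< j × code i ≡ code j) → ⊥
    collision (i , j , i<j , same) = labels-differ i<j (reason i) (reason j) (begin
      label (reason i)  ≡⟨ sym (toℕ-fromℕ< _) ⟩
      toℕ (code i)      ≡⟨ cong toℕ same ⟩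
      toℕ (code j)      ≡⟨ toℕ-fromℕ< _ ⟩
      label (reason j)  ∎)
      where open ≡-Reasoning

  -- A position (c , d) with c < l ≤ d has nim-value v ≥ l ∸ c: otherwise v
  -- would also be the value of some (c , y) with y < l ≤ d, an option of (c , d).
  mixed-lower-bound : ∀ c d → c < l → l ≤ d → l ≤ nimValue k l c d + c
  mixed-lower-bound c d c<l l≤d = ≮⇒≥ too-small
    where
    too-small : nimValue k l c d + c < l → ⊥
    too-small v+c<l =
      let c+v<l = subst (_< l) (+-comm _ c) v+c<l
          (y , y≤c+v , same) = row-attains c (nimValue k l c d) c+v<l
      in row-distinct c (≤-<-trans y≤c+v (<-≤-trans c+v<l l≤d)) same

  mixed-large : ∀ {m} c d → m ≤ l → c < m → l ≤ d → l ∸ m < nimValue k l c d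
  mixed-large {m} c d m≤l c<m l≤d = ≰⇒> λ v≤l∸m → <⇒≱ (begin-strict
      nimValue k l c d + c  <⟨ +-mono-≤-< v≤l∸m c<m ⟩
      l ∸ m + m             ≡⟨ m∸n+n≡m m≤l ⟩
      l                     ∎) (mixed-lower-bound c d (<-≤-trans c<m m≤l) l≤d)
    where open ≤-Reasoning

  straddling-large : ∀ {m} c d → m ≤ l → c ⊓ d < m → l ≤ c ⊔ d → l ∸ m < nimValue k l c d
  straddling-large {m} c d m≤l min<m l≤max with ≤-total c d
  ... | inj₁ c≤d = mixed-large c d m≤l (subst (_< m) (m≤n⇒m⊓n≡m c≤d) min<m)
                                       (subst (l ≤_) (m≤n⇒m⊔n≡n c≤d) l≤max)
  ... | inj₂ d≤c = subst (l ∸ m <_) (value-symmetric d c)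
                     (mixed-large d c m≤l (subst (_< m) (m≥n⇒m⊓n≡n d≤c) min<m)
                                          (subst (l ≤_) (m≥n⇒m⊔n≡m d≤c) l≤max))

module Transfer (k k′ l : ℕ) (k<k′ : k < k′) (k′≤l : k′ ≤ l) where
  private
    module W  = Game k l
    module W′ = Game k′ l

  Agree : ℕ → ℕ → Set
  Agree x y = ∀ g → g ≤ l ∸ k′ → (nimValue k l x y ≡ g ⇔ nimValue k′ l x y ≡ g)

  -- If the games agree on all positions below (a , b), then (a , b) has the
  -- same options of each value ≤ l ∸ k′ in both: the extra diagonal moves of
  -- W_{k,l} only reach straddling positions, whose values exceed l ∸ k′.
  options-agree : ∀ {a b} → (∀ x y → x + y < a + b → Agree x y) →
                  ∀ w → w ≤ l ∸ k′ → W.Option a b w ⇔ W′.Option a b w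
  options-agree {a} {b} agree w w≤ = mk⇔ to from
    where
    to : W.Option a b w → W′.Option a b w
    to ((x , y) , m , w≡) with move-strengthen m
    ... | inj₁ m′ = (x , y) , m′ , Equivalence.to (agree x y (move-decreases m) w w≤) w≡
    ... | inj₂ (min<k′ , l≤max) =
          ⊥-elim (<⇒≱ (W.straddling-large x y k′≤l min<k′ l≤max) (subst (_≤ l ∸ k′) (sym w≡) w≤))
    from : W′.Option a b w → W.Option a b w
    from ((x , y) , m′ , w≡) =
      (x , y) , move-weaken (<⇒≤ k<k′) m′ , Equivalence.from (agree x y (move-decreases m′) w w≤) w≡

  agree-everywhere : ∀ a b → Agree a b
  agree-everywhere = position-ind Agree λ a b agree g g≤ →
    ⇔.trans (W.value-char a b g)
      (⇔.trans (IsMex-cong (λ w w≤g → options-agree agree w (≤-trans w≤g g≤)))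
               (⇔.sym (W′.value-char a b g)))

theorem5 : (k k′ l : ℕ) → k < k′ → k′ ≤ l →
           (g : ℕ) → g ≤ l ∸ k′ →
           (a b : ℕ) → (nimValue k l a b ≡ g ⇔ nimValue k′ l a b ≡ g)
theorem5 k k′ l k<k′ k′≤l g g≤ a b = Transfer.agree-everywhere k k′ l k<k′ k′≤l a b g g≤
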